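{- For $N\in\mathbb{N}$, \begin{equation*} \sum_{n=0}^{N}\left[\begin{matrix} N \\ n\end{matrix}\right] \frac{\left(\frac{ -b}{a}\right)_na^n q^\frac{n(n+1)}{2}}{(bq)_n}=\sum_{n=0}^{N}\left[\begin{matrix} N \\ n\end{matrix}\right]\frac{\left(\frac{ -a}{b}\right)_n(bq)_{N-n} (bq)^n}{(bq)_N}. \end{equation*}
   Context: $|q|<1$; $(a)_n=(a;q)_n=(1-a)(1-aq)\cdots(1-aq^{n-1})$ with $(a)_0=1$. The $q$-binomial coefficient is $\left[\begin{matrix} N \\ n\end{matrix}\right]=\frac{(q)_N}{(q)_n(q)_{N-n}}$ for $0\le n\le N$ and $0$ otherwise. Parameters $a,b$ are complex with all denominators nonzero. -}

module Defs where

open import Level using (_⊔_)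
open import Algebra.Bundles using (CommutativeRing)
open import Data.Nat as ℕ using (ℕ; zero; suc; _∸_; _≤?_)
open import Data.Nat.DivMod using (_/_)
open import Relation.Nullary using (¬_; yes; no)

-- A field, presented as a commutative ring with a total inverse
-- operation that is a genuine inverse on every nonzero element
-- (the value of 0⁻¹ is irrelevant).  ℂ is an instance.
record Field (c ℓ : Level.Level) : Set (Level.suc (c ⊔ ℓ)) where
  field
    commutativeRing : CommutativeRing c ℓ
  open CommutativeRing commutativeRing public
  field
    _⁻¹       : Carrier → Carrier
    ⁻¹-cong   : ∀ {x y} → x ≈ y → x ⁻¹ ≈ y ⁻¹
    ⁻¹-inverse : ∀ x → ¬ (x ≈ 0#) → x * (x ⁻¹) ≈ 1#

module FieldOps {c ℓ} (F : Field c ℓ) where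
  open Field F public

  infixl 7 _÷_
  _÷_ : Carrier → Carrier → Carrier
  x ÷ y = x * (y ⁻¹)

  pow : Carrier → ℕ → Carrier
  pow x zero    = 1#
  pow x (suc n) = x * pow x n

  poch : Carrier → Carrier → ℕ → Carrier
  poch q x zero    = 1#
  poch q x (suc n) = poch q x n * (1# - x * pow q n)

  qbin : Carrier → ℕ → ℕ → Carrier
  qbin q N n with n ≤? N
  ... | yes _ = poch q q N ÷ (poch q q n * poch q q (N ∸ n))
  ... | no  _ = 0#

  sumTo : ℕ → (ℕ → Carrier) → Carrier
  sumTo zero    f = f 0
  sumTo (suc N) f = sumTo N f + f (suc N)

  tri : ℕ → ℕ
  tri n = (n ℕ.* suc n) / 2

-- Clearing the denominator (bq;q)_N, both sides become polynomial sums in the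
-- Gaussian binomials, and each of them equals (-aq;q)_N, independently of b.
-- This is proved by induction on N, expanding [N+1, n] by one of the two
-- q-Pascal rules: the left sum with [N+1, n+1] = q^(n+1) [N, n+1] + [N, n],
-- which turns it into (1 + aq) times the left sum for (aq, bq); the right sum
-- with [N+1, n+1] = [N, n+1] + q^(N-n) [N, n], which turns it into the right
-- sum for N times 1 + aq^(N+1).
module Submission where

open import Defs
open import Data.Nat as ℕ using (ℕ; zero; suc; _∸_; _≤_; _<_; _≤?_; z≤n; s≤s)
import Data.Nat.Properties as ℕ
open import Data.Nat.DivMod using (_/_; m*n/n≡m; +-distrib-/-∣ʳ)
open import Data.Nat.Divisibility using (divides)
open import Data.Nat.Tactic.RingSolver using (solve-∀)
open import Data.Empty using (⊥-elim)
open import Relation.Nullary using (¬_; yes; no)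
open import Relation.Binary.PropositionalEquality as ≡ using (_≡_)

tri-suc : ∀ n → (suc n ℕ.* suc (suc n)) / 2 ≡ (n ℕ.* suc n) / 2 ℕ.+ suc n
tri-suc n = begin
  (suc n ℕ.* suc (suc n)) / 2             ≡⟨ ≡.cong (_/ 2) (expand n) ⟩
  (n ℕ.* suc n ℕ.+ suc n ℕ.* 2) / 2       ≡⟨ +-distrib-/-∣ʳ (n ℕ.* suc n) (divides (suc n) ≡.refl) ⟩
  (n ℕ.* suc n) / 2 ℕ.+ (suc n ℕ.* 2) / 2 ≡⟨ ≡.cong ((n ℕ.* suc n) / 2 ℕ.+_) (m*n/n≡m (suc n) 2) ⟩
  (n ℕ.* suc n) / 2 ℕ.+ suc n             ∎
  where
  open ≡.≡-Reasoning
  expand : ∀ n → suc n ℕ.* suc (suc n) ≡ n ℕ.* suc n ℕ.+ suc n ℕ.* 2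
  expand = solve-∀

module _ {r ℓ} (F : Field r ℓ) where
  open FieldOps F hiding (zero)
  open import Relation.Binary.Reasoning.Setoid setoid
  open import Algebra.Properties.Ring ring using (-‿distribˡ-*; -‿distribʳ-*; -‿involutive)
  open import Algebra.Properties.CommutativeSemigroup *-commutativeSemigroup
    using (interchange; xy∙z≈xz∙y)
  open import Algebra.Properties.CommutativeSemigroup +-commutativeSemigroup
    using () renaming (interchange to +-interchange)
  open import Algebra.Solver.Ring.NaturalCoefficients.Default commutativeSemiring
    using (solve; _:=_; _:+_; _:*_)

  x-y+y≈x : ∀ x y → (x - y) + y ≈ x
  x-y+y≈x x y = begin
    (x - y) + y   ≈⟨ +-assoc x (- y) y ⟩
    x + (- y + y) ≈⟨ +-congˡ (-‿inverseˡ y) ⟩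
    x + 0#        ≈⟨ +-identityʳ x ⟩
    x             ∎

  x*y≉0⇒x≉0 : ∀ {x y} → ¬ (x * y ≈ 0#) → ¬ (x ≈ 0#)
  x*y≉0⇒x≉0 {x} {y} xy≉0 x≈0 = xy≉0 (trans (*-congʳ x≈0) (zeroˡ y))

  x*y≉0⇒y≉0 : ∀ {x y} → ¬ (x * y ≈ 0#) → ¬ (y ≈ 0#)
  x*y≉0⇒y≉0 {x} {y} xy≉0 = x*y≉0⇒x≉0 (λ yx≈0 → xy≉0 (trans (*-comm x y) yx≈0))

  ⁻¹-unique : ∀ x y → ¬ (x ≈ 0#) → x * y ≈ 1# → y ≈ x ⁻¹
  ⁻¹-unique x y x≉0 xy≈1 = begin
    y              ≈⟨ sym (*-identityʳ y) ⟩
    y * 1#         ≈⟨ *-congˡ (sym (⁻¹-inverse x x≉0)) ⟩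
    y * (x * x ⁻¹) ≈⟨ sym (*-assoc y x (x ⁻¹)) ⟩
    (y * x) * x ⁻¹ ≈⟨ *-congʳ (trans (*-comm y x) xy≈1) ⟩
    1# * x ⁻¹      ≈⟨ *-identityˡ (x ⁻¹) ⟩
    x ⁻¹           ∎

  ÷-cancelʳ : ∀ x y z → ¬ (y ≈ 0#) → x * y ≈ z → z ÷ y ≈ x
  ÷-cancelʳ x y z y≉0 xy≈z = begin
    z * y ⁻¹       ≈⟨ *-congʳ (sym xy≈z) ⟩
    (x * y) * y ⁻¹ ≈⟨ *-assoc x y (y ⁻¹) ⟩
    x * (y * y ⁻¹) ≈⟨ *-congˡ (⁻¹-inverse y y≉0) ⟩
    x * 1#         ≈⟨ *-identityʳ x ⟩
    x              ∎

  factor⁻¹≈cofactor÷ : ∀ x y z → ¬ (z ≈ 0#) → x * y ≈ z → x ⁻¹ ≈ y ÷ z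
  factor⁻¹≈cofactor÷ x y z z≉0 xy≈z = sym (⁻¹-unique x (y ÷ z) x≉0 (begin
    x * (y * z ⁻¹) ≈⟨ sym (*-assoc x y (z ⁻¹)) ⟩
    (x * y) * z ⁻¹ ≈⟨ *-congʳ xy≈z ⟩
    z * z ⁻¹       ≈⟨ ⁻¹-inverse z z≉0 ⟩
    1#             ∎))
    where
    x≉0 : ¬ (x ≈ 0#)
    x≉0 = x*y≉0⇒x≉0 (λ xy≈0 → z≉0 (trans (sym xy≈z) xy≈0))

  pow-+ : ∀ x m n → pow x (m ℕ.+ n) ≈ pow x m * pow x n
  pow-+ x zero    n = sym (*-identityˡ (pow x n))
  pow-+ x (suc m) n = trans (*-congˡ (pow-+ x m n)) (sym (*-assoc x (pow x m) (pow x n)))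

  pow-distrib-* : ∀ x y n → pow (x * y) n ≈ pow x n * pow y n
  pow-distrib-* x y zero    = sym (*-identityˡ 1#)
  pow-distrib-* x y (suc n) =
    trans (*-congˡ (pow-distrib-* x y n)) (interchange x y (pow x n) (pow y n))

  sumTo-cong : ∀ N {f g : ℕ → Carrier} → (∀ n → n ≤ N → f n ≈ g n) → sumTo N f ≈ sumTo N g
  sumTo-cong zero    f≈g = f≈g 0 z≤n
  sumTo-cong (suc N) f≈g =
    +-cong (sumTo-cong N (λ n n≤N → f≈g n (ℕ.m≤n⇒m≤1+n n≤N))) (f≈g (suc N) ℕ.≤-refl)

  sumTo-+ : ∀ N (f g : ℕ → Carrier) → sumTo N (λ n → f n + g n) ≈ sumTo N f + sumTo N g
  sumTo-+ zero    f g = refl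
  sumTo-+ (suc N) f g = trans (+-congʳ (sumTo-+ N f g)) (+-interchange _ _ _ _)

  sumTo-*ˡ : ∀ N x (f : ℕ → Carrier) → sumTo N (λ n → x * f n) ≈ x * sumTo N f
  sumTo-*ˡ zero    x f = refl
  sumTo-*ˡ (suc N) x f = trans (+-congʳ (sumTo-*ˡ N x f)) (sym (distribˡ x _ _))

  sumTo-*ʳ : ∀ N x (f : ℕ → Carrier) → sumTo N (λ n → f n * x) ≈ sumTo N f * x
  sumTo-*ʳ zero    x f = refl
  sumTo-*ʳ (suc N) x f = trans (+-congʳ (sumTo-*ʳ N x f)) (sym (distribʳ x _ _))

  sumTo-unfoldˡ : ∀ N (f : ℕ → Carrier) → sumTo (suc N) f ≈ f 0 + sumTo N (λ n → f (suc n))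
  sumTo-unfoldˡ zero    f = refl
  sumTo-unfoldˡ (suc N) f = trans (+-congʳ (sumTo-unfoldˡ N f)) (+-assoc _ _ _)

  module _ (q : Carrier) where

    poch-cong : ∀ {x y} n → x ≈ y → poch q x n ≈ poch q y n
    poch-cong zero    x≈y = refl
    poch-cong (suc n) x≈y = *-cong (poch-cong n x≈y) (+-congˡ (-‿cong (*-congʳ x≈y)))

    poch-unfoldˡ : ∀ x n → poch q x (suc n) ≈ (1# - x) * poch q (x * q) n
    poch-unfoldˡ x zero = begin
      1# * (1# - x * 1#) ≈⟨ *-identityˡ _ ⟩
      1# - x * 1#        ≈⟨ +-congˡ (-‿cong (*-identityʳ x)) ⟩
      1# - x             ≈⟨ sym (*-identityʳ _) ⟩
      (1# - x) * 1#      ∎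
    poch-unfoldˡ x (suc n) = begin
      poch q x (suc n) * (1# - x * (q * pow q n))
        ≈⟨ *-cong (poch-unfoldˡ x n) (+-congˡ (-‿cong (sym (*-assoc x q (pow q n))))) ⟩
      ((1# - x) * poch q (x * q) n) * (1# - (x * q) * pow q n)
        ≈⟨ *-assoc _ _ _ ⟩
      (1# - x) * poch q (x * q) (suc n) ∎

    poch-+ : ∀ x m n → poch q x (m ℕ.+ n) ≈ poch q x m * poch q (x * pow q m) n
    poch-+ x m zero rewrite ℕ.+-identityʳ m = sym (*-identityʳ _)
    poch-+ x m (suc n) rewrite ℕ.+-suc m n = begin
      poch q x (m ℕ.+ n) * (1# - x * pow q (m ℕ.+ n))
        ≈⟨ *-cong (poch-+ x m n) (+-congˡ (-‿cong x*qᵐ⁺ⁿ)) ⟩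
      (poch q x m * poch q (x * pow q m) n) * (1# - (x * pow q m) * pow q n)
        ≈⟨ *-assoc _ _ _ ⟩
      poch q x m * poch q (x * pow q m) (suc n) ∎
      where
      x*qᵐ⁺ⁿ : x * pow q (m ℕ.+ n) ≈ (x * pow q m) * pow q n
      x*qᵐ⁺ⁿ = trans (*-congˡ (pow-+ q m n)) (sym (*-assoc _ _ _))

    pow-tri-suc : ∀ n → pow q (tri (suc n)) ≈ pow q (tri n) * (q * pow q n)
    pow-tri-suc n = trans (reflexive (≡.cong (pow q) (tri-suc n))) (pow-+ q (tri n) (suc n))

    -- hpoch a b n = (a + b)(a + bq)⋯(a + bq^(n-1)), the division-free form of
    -- a^n (-b/a;q)_n.
    hpoch : Carrier → Carrier → ℕ → Carrier
    hpoch a b zero    = 1#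
    hpoch a b (suc n) = hpoch a b n * (a + b * pow q n)

    hpoch-unfoldˡ : ∀ a b n → hpoch a b (suc n) ≈ (a + b) * hpoch a (b * q) n
    hpoch-unfoldˡ a b zero = begin
      1# * (a + b * 1#) ≈⟨ *-identityˡ _ ⟩
      a + b * 1#        ≈⟨ +-congˡ (*-identityʳ b) ⟩
      a + b             ≈⟨ sym (*-identityʳ _) ⟩
      (a + b) * 1#      ∎
    hpoch-unfoldˡ a b (suc n) = begin
      hpoch a b (suc n) * (a + b * (q * pow q n))
        ≈⟨ *-cong (hpoch-unfoldˡ a b n) (+-congˡ (sym (*-assoc b q (pow q n)))) ⟩
      ((a + b) * hpoch a (b * q) n) * (a + (b * q) * pow q n)
        ≈⟨ *-assoc _ _ _ ⟩
      (a + b) * hpoch a (b * q) (suc n) ∎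

    hpoch-*q : ∀ a b n → hpoch (a * q) (b * q) n ≈ pow q n * hpoch a b n
    hpoch-*q a b zero    = sym (*-identityˡ 1#)
    hpoch-*q a b (suc n) = begin
      hpoch (a * q) (b * q) n * (a * q + (b * q) * pow q n)
        ≈⟨ *-congʳ (hpoch-*q a b n) ⟩
      (pow q n * hpoch a b n) * (a * q + (b * q) * pow q n)
        ≈⟨ solve 5 (λ qⁿ h a b q → (qⁿ :* h) :* (a :* q :+ (b :* q) :* qⁿ)
                                  := (q :* qⁿ) :* (h :* (a :+ b :* qⁿ)))
                   refl (pow q n) (hpoch a b n) a b q ⟩
      pow q (suc n) * hpoch a b (suc n) ∎

    poch-*-pow≈hpoch : ∀ a b → ¬ (a ≈ 0#) → ∀ n → poch q ((- b) ÷ a) n * pow a n ≈ hpoch a b n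
    poch-*-pow≈hpoch a b a≉0 zero    = *-identityˡ 1#
    poch-*-pow≈hpoch a b a≉0 (suc n) = begin
      (poch q c n * (1# - c * qⁿ)) * (a * pow a n)
        ≈⟨ *-congˡ (*-comm a (pow a n)) ⟩
      (poch q c n * (1# - c * qⁿ)) * (pow a n * a)
        ≈⟨ interchange _ _ _ _ ⟩
      (poch q c n * pow a n) * ((1# - c * qⁿ) * a)
        ≈⟨ *-cong (poch-*-pow≈hpoch a b a≉0 n) factor ⟩
      hpoch a b n * (a + b * qⁿ) ∎
      where
      c  = (- b) ÷ a
      qⁿ = pow q n
      c*qⁿ*a≈-b*qⁿ : (c * qⁿ) * a ≈ - (b * qⁿ)
      c*qⁿ*a≈-b*qⁿ = begin
        ((- b) * a ⁻¹ * qⁿ) * a   ≈⟨ solve 4 (λ b′ a′ qⁿ a → (b′ :* a′ :* qⁿ) :* a := (b′ :* qⁿ) :* (a :* a′))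
                                         refl (- b) (a ⁻¹) qⁿ a ⟩
        ((- b) * qⁿ) * (a * a ⁻¹) ≈⟨ *-congˡ (⁻¹-inverse a a≉0) ⟩
        ((- b) * qⁿ) * 1#         ≈⟨ *-identityʳ _ ⟩
        (- b) * qⁿ                ≈⟨ sym (-‿distribˡ-* b qⁿ) ⟩
        - (b * qⁿ)                ∎
      factor : (1# - c * qⁿ) * a ≈ a + b * qⁿ
      factor = begin
        (1# - c * qⁿ) * a          ≈⟨ distribʳ a 1# (- (c * qⁿ)) ⟩
        1# * a + - (c * qⁿ) * a    ≈⟨ +-cong (*-identityˡ a) (sym (-‿distribˡ-* (c * qⁿ) a)) ⟩
        a + - ((c * qⁿ) * a)       ≈⟨ +-congˡ (-‿cong c*qⁿ*a≈-b*qⁿ) ⟩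
        a + - (- (b * qⁿ))         ≈⟨ +-congˡ (-‿involutive _) ⟩
        a + b * qⁿ                 ∎

    -- The Gaussian binomial via the q-Pascal rule; unlike qbin it involves no
    -- division, so it is meaningful even when (q;q)_N = 0.
    qbinomial : ℕ → ℕ → Carrier
    qbinomial _       zero    = 1#
    qbinomial zero    (suc n) = 0#
    qbinomial (suc N) (suc n) = pow q (suc n) * qbinomial N (suc n) + qbinomial N n

    qbinomial-vanish : ∀ {N n} → N < n → qbinomial N n ≈ 0#
    qbinomial-vanish {zero}  {suc n} _         = refl
    qbinomial-vanish {suc N} {suc n} (s≤s N<n) = begin
      pow q (suc n) * qbinomial N (suc n) + qbinomial N n
        ≈⟨ +-cong (*-congˡ (qbinomial-vanish (ℕ.m<n⇒m<1+n N<n))) (qbinomial-vanish N<n) ⟩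
      pow q (suc n) * 0# + 0# ≈⟨ +-identityʳ _ ⟩
      pow q (suc n) * 0#      ≈⟨ zeroʳ _ ⟩
      0#                      ∎

    qbinomial-diag : ∀ N → qbinomial N N ≈ 1#
    qbinomial-diag zero    = refl
    qbinomial-diag (suc N) = begin
      pow q (suc N) * qbinomial N (suc N) + qbinomial N N
        ≈⟨ +-cong (*-congˡ (qbinomial-vanish {N} ℕ.≤-refl)) (qbinomial-diag N) ⟩
      pow q (suc N) * 0# + 1# ≈⟨ +-congʳ (zeroʳ _) ⟩
      0# + 1#                 ≈⟨ +-identityˡ 1# ⟩
      1#                      ∎

    -- For m ≥ N the truncated exponent N ∸ suc m breaks q · q^(N-m-1) = q^(N-m),
    -- but then the binomial coefficient vanishes.
    pascal′-coefficient : ∀ N m →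
      pow q (suc (suc m)) * (pow q (N ∸ suc m) * qbinomial N (suc m))
        ≈ pow q (N ∸ m) * (pow q (suc m) * qbinomial N (suc m))
    pascal′-coefficient N m with suc m ≤? N
    ... | yes m<N = begin
      (q * pow q (suc m)) * (pow q (N ∸ suc m) * qbinomial N (suc m))
        ≈⟨ interchange _ _ _ _ ⟩
      pow q (suc (N ∸ suc m)) * (pow q (suc m) * qbinomial N (suc m))
        ≈⟨ *-congʳ (reflexive (≡.cong (pow q) (≡.sym (ℕ.+-∸-assoc 1 m<N)))) ⟩
      pow q (N ∸ m) * (pow q (suc m) * qbinomial N (suc m)) ∎
    ... | no m≮N = trans (absorbs _ _) (sym (absorbs _ _))
      where
      absorbs : ∀ x y → x * (y * qbinomial N (suc m)) ≈ 0#
      absorbs x y = trans (*-congˡ (trans (*-congˡ (qbinomial-vanish (ℕ.≰⇒> m≮N))) (zeroʳ y))) (zeroʳ x)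

    qbinomial-pascal′ : ∀ N n →
      qbinomial (suc N) (suc n) ≈ qbinomial N (suc n) + pow q (N ∸ n) * qbinomial N n
    qbinomial-pascal′ zero n rewrite ℕ.0∸n≡0 n = begin
      pow q (suc n) * 0# + qbinomial 0 n ≈⟨ +-congʳ (zeroʳ _) ⟩
      0# + qbinomial 0 n                 ≈⟨ +-congˡ (sym (*-identityˡ _)) ⟩
      0# + 1# * qbinomial 0 n            ∎
    qbinomial-pascal′ (suc N) zero = begin
      (q * 1#) * qbinomial (suc N) 1 + 1#
        ≈⟨ +-congʳ (*-cong (*-identityʳ q) (trans (qbinomial-pascal′ N zero) (+-congˡ (*-identityʳ _)))) ⟩
      q * (qbinomial N 1 + pow q N) + 1#
        ≈⟨ solve 4 (λ q g qᴺ o → q :* (g :+ qᴺ) :+ o := (q :* g :+ o) :+ q :* qᴺ)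
                   refl q (qbinomial N 1) (pow q N) 1# ⟩
      (q * qbinomial N 1 + 1#) + q * pow q N
        ≈⟨ sym (+-cong (+-congʳ (*-congʳ (*-identityʳ q))) (*-identityʳ _)) ⟩
      ((q * 1#) * qbinomial N 1 + 1#) + (q * pow q N) * 1# ∎
    qbinomial-pascal′ (suc N) (suc m) = begin
      A * qbinomial (suc N) (suc (suc m)) + qbinomial (suc N) (suc m)
        ≈⟨ +-cong (*-congˡ (qbinomial-pascal′ N (suc m))) (qbinomial-pascal′ N m) ⟩
      A * (g₂ + pow q (N ∸ suc m) * g₁) + (g₁ + qᴺ⁻ᵐ * g₀)
        ≈⟨ +-congʳ (trans (distribˡ A _ _) (+-congˡ (pascal′-coefficient N m))) ⟩
      (A * g₂ + qᴺ⁻ᵐ * (B * g₁)) + (g₁ + qᴺ⁻ᵐ * g₀)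
        ≈⟨ solve 6 (λ A g₂ B g₁ g₀ p → (A :* g₂ :+ p :* (B :* g₁)) :+ (g₁ :+ p :* g₀)
                                       := (A :* g₂ :+ g₁) :+ p :* (B :* g₁ :+ g₀))
                   refl A g₂ B g₁ g₀ qᴺ⁻ᵐ ⟩
      (A * g₂ + g₁) + qᴺ⁻ᵐ * (B * g₁ + g₀) ∎
      where
      A = pow q (suc (suc m))
      B = pow q (suc m)
      g₂ = qbinomial N (suc (suc m))
      g₁ = qbinomial N (suc m)
      g₀ = qbinomial N m
      qᴺ⁻ᵐ = pow q (N ∸ m)

    x*[1-y]+[1-x]≈1-x*y : ∀ x y → x * (1# - y) + (1# - x) ≈ 1# - x * y
    x*[1-y]+[1-x]≈1-x*y x y = begin
      x * (1# - y) + (1# - x)          ≈⟨ +-congʳ (distribˡ x 1# (- y)) ⟩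
      (x * 1# + x * - y) + (1# - x)    ≈⟨ +-congʳ (+-cong (*-identityʳ x) (sym (-‿distribʳ-* x y))) ⟩
      (x - x * y) + (1# - x)           ≈⟨ solve 4 (λ x y o x′ → (x :+ y) :+ (o :+ x′) := (x :+ x′) :+ (o :+ y))
                                                refl x (- (x * y)) 1# (- x) ⟩
      (x - x) + (1# - x * y)           ≈⟨ +-congʳ (-‿inverseʳ x) ⟩
      0# + (1# - x * y)                ≈⟨ +-identityˡ _ ⟩
      1# - x * y                       ∎

    qbinomial-*-poch : ∀ {N} n k → n ℕ.+ k ≡ N →
      qbinomial N n * (poch q q n * poch q q k) ≈ poch q q N
    qbinomial-*-poch zero k ≡.refl = trans (*-identityˡ _) (*-identityˡ _)
    qbinomial-*-poch (suc n) zero ≡.refl rewrite ℕ.+-identityʳ n =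
      trans (*-congʳ (qbinomial-diag (suc n))) (trans (*-identityˡ _) (*-identityʳ _))
    qbinomial-*-poch (suc n) (suc k) ≡.refl = begin
      (A * g₁ + g₀) * ((pₙ * wₙ) * (pₖ * wₖ))
        ≈⟨ solve 7 (λ A g₁ g₀ pₙ wₙ pₖ wₖ →
                      (A :* g₁ :+ g₀) :* ((pₙ :* wₙ) :* (pₖ :* wₖ))
                      := (A :* wₖ) :* (g₁ :* ((pₙ :* wₙ) :* pₖ))
                        :+ wₙ :* (g₀ :* (pₙ :* (pₖ :* wₖ))))
                   refl A g₁ g₀ pₙ wₙ pₖ wₖ ⟩
      (A * wₖ) * (g₁ * ((pₙ * wₙ) * pₖ)) + wₙ * (g₀ * (pₙ * (pₖ * wₖ)))
        ≈⟨ +-cong (*-congˡ (qbinomial-*-poch (suc n) k (≡.sym (ℕ.+-suc n k))))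
                  (*-congˡ (qbinomial-*-poch n (suc k) ≡.refl)) ⟩
      (A * wₖ) * P + wₙ * P     ≈⟨ trans (sym (distribʳ P _ _)) (*-comm _ P) ⟩
      P * (A * wₖ + wₙ)         ≈⟨ *-congˡ (x*[1-y]+[1-x]≈1-x*y A (q * pow q k)) ⟩
      P * (1# - A * (q * pow q k)) ≈⟨ *-congˡ (+-congˡ (-‿cong qⁿ⁺¹*qᵏ⁺¹)) ⟩
      P * (1# - q * pow q (n ℕ.+ suc k)) ∎
      where
      A = pow q (suc n)
      g₁ = qbinomial (n ℕ.+ suc k) (suc n)
      g₀ = qbinomial (n ℕ.+ suc k) n
      pₙ = poch q q n
      wₙ = 1# - q * pow q n
      pₖ = poch q q k
      wₖ = 1# - q * pow q k
      P = poch q q (n ℕ.+ suc k)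
      qⁿ⁺¹*qᵏ⁺¹ : A * (q * pow q k) ≈ q * pow q (n ℕ.+ suc k)
      qⁿ⁺¹*qᵏ⁺¹ = trans (*-assoc q (pow q n) _) (*-congˡ (sym (pow-+ q n (suc k))))

    qbin≈qbinomial : ∀ {N n} → n ≤ N → ¬ (poch q q N ≈ 0#) → qbin q N n ≈ qbinomial N n
    qbin≈qbinomial {N} {n} n≤N qq≉0 with n ≤? N
    ... | no n≰N = ⊥-elim (n≰N n≤N)
    ... | yes _  = ÷-cancelʳ (qbinomial N n) _ (poch q q N) denominator≉0 factorisation
      where
      factorisation : qbinomial N n * (poch q q n * poch q q (N ∸ n)) ≈ poch q q N
      factorisation = qbinomial-*-poch n (N ∸ n) (ℕ.m+[n∸m]≡n n≤N)
      denominator≉0 : ¬ (poch q q n * poch q q (N ∸ n) ≈ 0#)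
      denominator≉0 = x*y≉0⇒y≉0 (λ e → qq≉0 (trans (sym factorisation) e))

    sumTo-qbinomial-unfoldˡ : ∀ N (f : ℕ → Carrier) →
      sumTo N (λ n → qbinomial N n * f n) ≈ f 0 + sumTo N (λ n → qbinomial N (suc n) * f (suc n))
    sumTo-qbinomial-unfoldˡ N f = begin
      sumTo N g                               ≈⟨ sym (+-identityʳ _) ⟩
      sumTo N g + 0#                          ≈⟨ +-congˡ (sym top≈0) ⟩
      sumTo (suc N) g                         ≈⟨ sumTo-unfoldˡ N g ⟩
      1# * f 0 + sumTo N (λ n → g (suc n))    ≈⟨ +-congʳ (*-identityˡ _) ⟩
      f 0 + sumTo N (λ n → g (suc n))         ∎
      where
      g = λ n → qbinomial N n * f n
      top≈0 : g (suc N) ≈ 0#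
      top≈0 = trans (*-congʳ (qbinomial-vanish {N} ℕ.≤-refl)) (zeroˡ _)

    sumTo-qbinomial-pascal : ∀ N (f : ℕ → Carrier) →
      sumTo (suc N) (λ n → qbinomial (suc N) n * f n)
        ≈ sumTo N (λ n → qbinomial N n * (pow q n * f n)) + sumTo N (λ n → qbinomial N n * f (suc n))
    sumTo-qbinomial-pascal N f = begin
      sumTo (suc N) (λ n → qbinomial (suc N) n * f n)
        ≈⟨ sumTo-unfoldˡ N _ ⟩
      1# * f 0 + sumTo N (λ n → (pow q (suc n) * qbinomial N (suc n) + qbinomial N n) * f (suc n))
        ≈⟨ +-congˡ (trans (sumTo-cong N (λ n _ → split n)) (sumTo-+ N _ _)) ⟩
      1# * f 0 + (sumTo N (λ n → qbinomial N (suc n) * (pow q (suc n) * f (suc n)))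
                  + sumTo N (λ n → qbinomial N n * f (suc n)))
        ≈⟨ sym (+-assoc _ _ _) ⟩
      (1# * f 0 + sumTo N (λ n → qbinomial N (suc n) * (pow q (suc n) * f (suc n))))
        + sumTo N (λ n → qbinomial N n * f (suc n))
        ≈⟨ +-congʳ (sym (sumTo-qbinomial-unfoldˡ N (λ n → pow q n * f n))) ⟩
      sumTo N (λ n → qbinomial N n * (pow q n * f n)) + sumTo N (λ n → qbinomial N n * f (suc n)) ∎
      where
      split : ∀ n → (pow q (suc n) * qbinomial N (suc n) + qbinomial N n) * f (suc n)
                    ≈ qbinomial N (suc n) * (pow q (suc n) * f (suc n)) + qbinomial N n * f (suc n)
      split n = solve 4 (λ p g₁ g₀ x → (p :* g₁ :+ g₀) :* x := g₁ :* (p :* x) :+ g₀ :* x)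
                        refl (pow q (suc n)) (qbinomial N (suc n)) (qbinomial N n) (f (suc n))

    sumTo-qbinomial-pascal′ : ∀ N (f : ℕ → Carrier) →
      sumTo (suc N) (λ n → qbinomial (suc N) n * f n)
        ≈ sumTo N (λ n → qbinomial N n * f n) + sumTo N (λ n → pow q (N ∸ n) * qbinomial N n * f (suc n))
    sumTo-qbinomial-pascal′ N f = begin
      sumTo (suc N) (λ n → qbinomial (suc N) n * f n)
        ≈⟨ sumTo-unfoldˡ N _ ⟩
      1# * f 0 + sumTo N (λ n → qbinomial (suc N) (suc n) * f (suc n))
        ≈⟨ +-congˡ (trans (sumTo-cong N (λ n _ → split n)) (sumTo-+ N _ _)) ⟩
      1# * f 0 + (sumTo N (λ n → qbinomial N (suc n) * f (suc n))
                  + sumTo N (λ n → pow q (N ∸ n) * qbinomial N n * f (suc n)))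
        ≈⟨ sym (+-assoc _ _ _) ⟩
      (1# * f 0 + sumTo N (λ n → qbinomial N (suc n) * f (suc n)))
        + sumTo N (λ n → pow q (N ∸ n) * qbinomial N n * f (suc n))
        ≈⟨ +-congʳ (trans (+-congʳ (*-identityˡ _)) (sym (sumTo-qbinomial-unfoldˡ N f))) ⟩
      sumTo N (λ n → qbinomial N n * f n) + sumTo N (λ n → pow q (N ∸ n) * qbinomial N n * f (suc n)) ∎
      where
      split : ∀ n → qbinomial (suc N) (suc n) * f (suc n)
                    ≈ qbinomial N (suc n) * f (suc n) + pow q (N ∸ n) * qbinomial N n * f (suc n)
      split n = trans (*-congʳ (qbinomial-pascal′ N n)) (distribʳ _ _ _)

    lhsNumerator : ℕ → Carrier → Carrier → Carrier
    lhsNumerator N a b = sumTo N λ n →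
      qbinomial N n * (hpoch a b n * pow q (tri n) * poch q (b * q * pow q n) (N ∸ n))

    rhsNumerator : ℕ → Carrier → Carrier → Carrier
    rhsNumerator N a b = sumTo N λ n →
      qbinomial N n * (pow q n * hpoch b a n * poch q (b * q) (N ∸ n))

    -- The summands combine by q^n (1 - bq^(n+1)) + q^(n+1) (a + bq^n) = q^n (1 + aq).
    lhsNumerator-step : ∀ N a b n → n ≤ N →
      let f = λ n → hpoch a b n * pow q (tri n) * poch q (b * q * pow q n) (suc N ∸ n) in
      qbinomial N n * (pow q n * f n) + qbinomial N n * f (suc n)
        ≈ (1# + a * q) * (qbinomial N n * (hpoch (a * q) (b * q) n * pow q (tri n)
                                           * poch q (b * q * q * pow q n) (N ∸ n)))
    lhsNumerator-step N a b n n≤N = begin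
      g * (qⁿ * (h * t * poch q (b * q * qⁿ) (suc N ∸ n)))
        + g * (h * (a + b * qⁿ) * pow q (tri (suc n)) * poch q (b * q * (q * qⁿ)) (N ∸ n))
        ≈⟨ +-cong (*-congˡ (*-congˡ (*-congˡ unfold-first)))
                  (*-congˡ (*-cong (*-congˡ (pow-tri-suc n)) shift)) ⟩
      g * (qⁿ * (h * t * (w * R))) + g * (h * (a + b * qⁿ) * (t * (q * qⁿ)) * R)
        ≈⟨ solve 9 (λ g qⁿ h t w R a b q →
                      g :* (qⁿ :* (h :* t :* (w :* R)))
                        :+ g :* (h :* (a :+ b :* qⁿ) :* (t :* (q :* qⁿ)) :* R)
                      := g :* (qⁿ :* h :* t :* R) :* (w :+ b :* q :* qⁿ)
                        :+ g :* (qⁿ :* h :* t :* R) :* (a :* q))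
                   refl g qⁿ h t w R a b q ⟩
      Z * (w + b * q * qⁿ) + Z * (a * q)
        ≈⟨ +-congʳ (*-congˡ (x-y+y≈x 1# (b * q * qⁿ))) ⟩
      Z * 1# + Z * (a * q)
        ≈⟨ trans (sym (distribˡ _ 1# (a * q))) (*-comm _ _) ⟩
      (1# + a * q) * Z
        ≈⟨ *-congˡ (*-congˡ (*-congʳ (*-congʳ (sym (hpoch-*q a b n))))) ⟩
      (1# + a * q) * (g * (hpoch (a * q) (b * q) n * t * R)) ∎
      where
      g  = qbinomial N n
      qⁿ = pow q n
      h  = hpoch a b n
      t  = pow q (tri n)
      w  = 1# - b * q * qⁿ
      R  = poch q (b * q * q * qⁿ) (N ∸ n)
      Z  = g * (qⁿ * h * t * R)
      unfold-first : poch q (b * q * qⁿ) (suc N ∸ n) ≈ w * R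
      unfold-first = begin
        poch q (b * q * qⁿ) (suc N ∸ n)       ≈⟨ reflexive (≡.cong (poch q (b * q * qⁿ)) (ℕ.+-∸-assoc 1 n≤N)) ⟩
        poch q (b * q * qⁿ) (suc (N ∸ n))     ≈⟨ poch-unfoldˡ (b * q * qⁿ) (N ∸ n) ⟩
        w * poch q (b * q * qⁿ * q) (N ∸ n)   ≈⟨ *-congˡ (poch-cong (N ∸ n) (xy∙z≈xz∙y (b * q) qⁿ q)) ⟩
        w * R                                 ∎
      shift : poch q (b * q * (q * qⁿ)) (N ∸ n) ≈ R
      shift = poch-cong (N ∸ n) (sym (*-assoc (b * q) q qⁿ))

    lhsNumerator≈hpoch : ∀ N a b → lhsNumerator N a b ≈ hpoch 1# (a * q) N
    lhsNumerator≈hpoch zero    a b = trans (*-identityˡ _) (trans (*-identityʳ _) (*-identityˡ _))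
    lhsNumerator≈hpoch (suc N) a b = begin
      lhsNumerator (suc N) a b
        ≈⟨ sumTo-qbinomial-pascal N f ⟩
      sumTo N (λ n → qbinomial N n * (pow q n * f n)) + sumTo N (λ n → qbinomial N n * f (suc n))
        ≈⟨ sym (sumTo-+ N _ _) ⟩
      sumTo N (λ n → qbinomial N n * (pow q n * f n) + qbinomial N n * f (suc n))
        ≈⟨ sumTo-cong N (lhsNumerator-step N a b) ⟩
      sumTo N (λ n → (1# + a * q) * (qbinomial N n * (hpoch (a * q) (b * q) n * pow q (tri n)
                                                       * poch q (b * q * q * pow q n) (N ∸ n))))
        ≈⟨ sumTo-*ˡ N _ _ ⟩
      (1# + a * q) * lhsNumerator N (a * q) (b * q)
        ≈⟨ *-congˡ (lhsNumerator≈hpoch N (a * q) (b * q)) ⟩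
      (1# + a * q) * hpoch 1# (a * q * q) N
        ≈⟨ sym (hpoch-unfoldˡ 1# (a * q) N) ⟩
      hpoch 1# (a * q) (suc N) ∎
      where f = λ n → hpoch a b n * pow q (tri n) * poch q (b * q * pow q n) (suc N ∸ n)

    -- The summands combine by (1 - bq^(N-n+1)) + q^(N-n+1) (b + aq^n) = 1 + aq^(N+1).
    rhsNumerator-step : ∀ N a b n → n ≤ N →
      let f = λ n → pow q n * hpoch b a n * poch q (b * q) (suc N ∸ n) in
      qbinomial N n * f n + pow q (N ∸ n) * qbinomial N n * f (suc n)
        ≈ qbinomial N n * (pow q n * hpoch b a n * poch q (b * q) (N ∸ n)) * (1# + a * q * pow q N)
    rhsNumerator-step N a b n n≤N = begin
      g * (qⁿ * h * poch q (b * q) (suc N ∸ n)) + qᵏ * g * ((q * qⁿ) * (h * (b + a * qⁿ)) * R)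
        ≈⟨ +-congʳ (*-congˡ (*-congˡ (reflexive (≡.cong (poch q (b * q)) (ℕ.+-∸-assoc 1 n≤N))))) ⟩
      g * (qⁿ * h * (R * w)) + qᵏ * g * ((q * qⁿ) * (h * (b + a * qⁿ)) * R)
        ≈⟨ solve 9 (λ g qⁿ h R w qᵏ q a b →
                      g :* (qⁿ :* h :* (R :* w))
                        :+ qᵏ :* g :* ((q :* qⁿ) :* (h :* (b :+ a :* qⁿ)) :* R)
                      := g :* (qⁿ :* h :* R) :* (w :+ b :* q :* qᵏ)
                        :+ g :* (qⁿ :* h :* R) :* (a :* q :* (qᵏ :* qⁿ)))
                   refl g qⁿ h R w qᵏ q a b ⟩
      Z * (w + b * q * qᵏ) + Z * (a * q * (qᵏ * qⁿ))
        ≈⟨ +-cong (*-congˡ (x-y+y≈x 1# (b * q * qᵏ))) (*-congˡ (*-congˡ qᵏ*qⁿ≈qᴺ)) ⟩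
      Z * 1# + Z * (a * q * pow q N)
        ≈⟨ sym (distribˡ Z 1# _) ⟩
      Z * (1# + a * q * pow q N) ∎
      where
      g  = qbinomial N n
      qⁿ = pow q n
      h  = hpoch b a n
      qᵏ = pow q (N ∸ n)
      R  = poch q (b * q) (N ∸ n)
      w  = 1# - b * q * qᵏ
      Z  = g * (qⁿ * h * R)
      qᵏ*qⁿ≈qᴺ : qᵏ * qⁿ ≈ pow q N
      qᵏ*qⁿ≈qᴺ = trans (sym (pow-+ q (N ∸ n) n)) (reflexive (≡.cong (pow q) (ℕ.m∸n+n≡m n≤N)))

    rhsNumerator≈hpoch : ∀ N a b → rhsNumerator N a b ≈ hpoch 1# (a * q) N
    rhsNumerator≈hpoch zero    a b = trans (*-identityˡ _) (trans (*-identityʳ _) (*-identityˡ _))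
    rhsNumerator≈hpoch (suc N) a b = begin
      rhsNumerator (suc N) a b
        ≈⟨ sumTo-qbinomial-pascal′ N f ⟩
      sumTo N (λ n → qbinomial N n * f n) + sumTo N (λ n → pow q (N ∸ n) * qbinomial N n * f (suc n))
        ≈⟨ sym (sumTo-+ N _ _) ⟩
      sumTo N (λ n → qbinomial N n * f n + pow q (N ∸ n) * qbinomial N n * f (suc n))
        ≈⟨ sumTo-cong N (rhsNumerator-step N a b) ⟩
      sumTo N (λ n → qbinomial N n * (pow q n * hpoch b a n * poch q (b * q) (N ∸ n))
                     * (1# + a * q * pow q N))
        ≈⟨ sumTo-*ʳ N _ _ ⟩
      rhsNumerator N a b * (1# + a * q * pow q N)
        ≈⟨ *-congʳ (rhsNumerator≈hpoch N a b) ⟩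
      hpoch 1# (a * q) (suc N) ∎
      where f = λ n → pow q n * hpoch b a n * poch q (b * q) (suc N ∸ n)

    lhs-summand≈ : ∀ {N n a b} → n ≤ N → ¬ (a ≈ 0#) → ¬ (poch q q N ≈ 0#) → ¬ (poch q (b * q) N ≈ 0#) →
      qbin q N n * (poch q ((- b) ÷ a) n * pow a n * pow q (tri n) ÷ poch q (b * q) n)
        ≈ qbinomial N n * (hpoch a b n * pow q (tri n) * poch q (b * q * pow q n) (N ∸ n))
            ÷ poch q (b * q) N
    lhs-summand≈ {N} {n} {a} {b} n≤N a≉0 qq≉0 bqq≉0 = begin
      qbin q N n * (poch q ((- b) ÷ a) n * pow a n * t * poch q (b * q) n ⁻¹)
        ≈⟨ *-cong (qbin≈qbinomial n≤N qq≉0) (*-cong (*-congʳ (poch-*-pow≈hpoch a b a≉0 n)) head⁻¹) ⟩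
      g * ((h * t) * (R * D ⁻¹))  ≈⟨ *-congˡ (sym (*-assoc (h * t) R (D ⁻¹))) ⟩
      g * ((h * t * R) * D ⁻¹)    ≈⟨ sym (*-assoc g (h * t * R) (D ⁻¹)) ⟩
      g * (h * t * R) * D ⁻¹      ∎
      where
      g = qbinomial N n
      h = hpoch a b n
      t = pow q (tri n)
      R = poch q (b * q * pow q n) (N ∸ n)
      D = poch q (b * q) N
      head⁻¹ : poch q (b * q) n ⁻¹ ≈ R ÷ D
      head⁻¹ = factor⁻¹≈cofactor÷ _ R D bqq≉0 (begin
        poch q (b * q) n * R          ≈⟨ sym (poch-+ (b * q) n (N ∸ n)) ⟩
        poch q (b * q) (n ℕ.+ (N ∸ n)) ≡⟨ ≡.cong (poch q (b * q)) (ℕ.m+[n∸m]≡n n≤N) ⟩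
        D                             ∎)

    rhs-summand≈ : ∀ {N n a b} → n ≤ N → ¬ (b ≈ 0#) → ¬ (poch q q N ≈ 0#) →
      qbin q N n * (poch q ((- a) ÷ b) n * poch q (b * q) (N ∸ n) * pow (b * q) n ÷ poch q (b * q) N)
        ≈ qbinomial N n * (pow q n * hpoch b a n * poch q (b * q) (N ∸ n)) ÷ poch q (b * q) N
    rhs-summand≈ {N} {n} {a} {b} n≤N b≉0 qq≉0 = begin
      qbin q N n * (p * R * pow (b * q) n * D ⁻¹)
        ≈⟨ *-cong (qbin≈qbinomial n≤N qq≉0) (*-congʳ (*-congˡ (pow-distrib-* b q n))) ⟩
      g * (p * R * (pow b n * pow q n) * D ⁻¹)
        ≈⟨ solve 6 (λ g p R bⁿ qⁿ I → g :* (p :* R :* (bⁿ :* qⁿ) :* I) := g :* (qⁿ :* (p :* bⁿ) :* R) :* I)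
                   refl g p R (pow b n) (pow q n) (D ⁻¹) ⟩
      g * (pow q n * (p * pow b n) * R) * D ⁻¹
        ≈⟨ *-congʳ (*-congˡ (*-congʳ (*-congˡ (poch-*-pow≈hpoch b a b≉0 n)))) ⟩
      g * (pow q n * hpoch b a n * R) * D ⁻¹ ∎
      where
      g = qbinomial N n
      p = poch q ((- a) ÷ b) n
      R = poch q (b * q) (N ∸ n)
      D = poch q (b * q) N

theorem3p1 : ∀ {c ℓ} (F : Field c ℓ) → let open FieldOps F in
    ∀ (q a b : Carrier) (N : ℕ) →
    ¬ (a ≈ 0#) → ¬ (b ≈ 0#) →
    ¬ (poch q q N ≈ 0#) → ¬ (poch q (b * q) N ≈ 0#) →
    sumTo N (λ n → qbin q N n * (poch q ((- b) ÷ a) n * pow a n * pow q (tri n) ÷ poch q (b * q) n))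
      ≈ sumTo N (λ n → qbin q N n * (poch q ((- a) ÷ b) n * poch q (b * q) (N ∸ n) * pow (b * q) n ÷ poch q (b * q) N))
theorem3p1 F q a b N a≉0 b≉0 qq≉0 bqq≉0 = begin
  _                           ≈⟨ sumTo-cong F N (λ n n≤N → lhs-summand≈ F q n≤N a≉0 qq≉0 bqq≉0) ⟩
  _                           ≈⟨ sumTo-*ʳ F N _ _ ⟩
  lhsNumerator F q N a b ÷ D  ≈⟨ *-congʳ (lhsNumerator≈hpoch F q N a b) ⟩
  hpoch F q 1# (a * q) N ÷ D  ≈⟨ *-congʳ (sym (rhsNumerator≈hpoch F q N a b)) ⟩
  rhsNumerator F q N a b ÷ D  ≈⟨ sym (sumTo-*ʳ F N _ _) ⟩
  _                           ≈⟨ sym (sumTo-cong F N (λ n n≤N → rhs-summand≈ F q n≤N b≉0 qq≉0)) ⟩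
  _                           ∎
  where
  open FieldOps F
  open import Relation.Binary.Reasoning.Setoid setoid
  D = poch q (b * q) N
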